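{- For any symmetric function $F$ (with rational coefficients), there exists a unique supersymmetric function $\widehat{F}\in\Gamma$ such that $$\widehat{F}(\lambda_1,\lambda_2,\dots,\lambda_{\ell(\lambda)})=F\big(\widehat{c}_\square:\square\in S(\lambda)\big)$$ for every strict partition $\lambda$. Here $F(\widehat{c}_\square:\square\in S(\lambda))$ denotes the specialization of $F(x_1,x_2,\dots)$ in which the first $|\lambda|$ variables are replaced by the numbers $\widehat c_\square$, $\square\in S(\lambda)$ (in any order), and all other variables by $0$.
   Context: A strict partition is a finite strictly decreasing sequence $\lambda=(\lambda_1,\dots,\lambda_l)$ of positive integers (the empty partition included); $\ell(\lambda)=l$, $|\lambda|=\sum_i\lambda_i$. Its shifted Young diagram is $S(\lambda)=\{(i,j)\in\mathbb{Z}^2:1\le i\le\ell(\lambda),\ i\le j\le\lambda_i+i-1\}$. For a box $\square=(i,j)\in S(\lambda)$, its content is $c_\square=j-i$, and $\widehat c_\square=\tfrac12 c_\square(c_\square+1)$. $\Gamma$ is the $\mathbb{Q}$-subalgebra of the algebra of symmetric functions generated by the odd power sums $p_1,p_3,p_5,\dots$, where $p_r=x_1^r+x_2^r+\cdots$; its elements are called supersymmetric functions. For $f\in\Gamma$, $f(\lambda_1,\dots,\lambda_{\ell(\lambda)})$ means $f$ evaluated at $x_i=\lambda_i$ ($i\le\ell(\lambda)$), $x_i=0$ ($i>\ell(\lambda)$). -}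

module Defs where

open import Data.Nat as ℕ using (ℕ; zero; suc; _∸_; _<_)
open import Data.Integer using (+_)
open import Data.Rational as ℚ using (ℚ; 0ℚ; 1ℚ; _/_)
open import Data.Product using (_×_; _,_; Σ)
open import Data.List using (List; []; _∷_; map; _++_; upTo; foldr)
open import Data.List.Relation.Unary.All using (All)
open import Data.List.Relation.Unary.Linked using (Linked)
open import Relation.Binary.PropositionalEquality using (_≡_)

-- Symmetric functions over ℚ, presented as polynomial expressions in the
-- power sums p_1, p_2, p_3, ... (these generate Λ_ℚ as a ℚ-algebra).
-- `psuc r` denotes the power sum p_{r+1}.

data SymFun : Set where
  const : ℚ → SymFun
  psuc  : ℕ → SymFun
  _⊕_   : SymFun → SymFun → SymFun
  _⊗_   : SymFun → SymFun → SymFun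

-- Γ: the ℚ-subalgebra generated by the odd power sums p_1, p_3, p_5, ...
-- (p_{2k+1} = psuc (k + k)).
data InΓ : SymFun → Set where
  const : ∀ q → InΓ (const q)
  podd  : ∀ k → InΓ (psuc (k ℕ.+ k))
  _⊕_   : ∀ {f g} → InΓ f → InΓ g → InΓ (f ⊕ g)
  _⊗_   : ∀ {f g} → InΓ f → InΓ g → InΓ (f ⊗ g)

pow : ℚ → ℕ → ℚ
pow x zero    = 1ℚ
pow x (suc n) = x ℚ.* pow x n

sumℚ : List ℚ → ℚ
sumℚ = foldr ℚ._+_ 0ℚ

powerSum : ℕ → List ℚ → ℚ
powerSum r xs = sumℚ (map (λ x → pow x (suc r)) xs)

-- Specialization F(x_1,...,x_n,0,0,...) of a symmetric function.
eval : SymFun → List ℚ → ℚ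
eval (const q) xs = q
eval (psuc r)  xs = powerSum r xs
eval (f ⊕ g)   xs = eval f xs ℚ.+ eval g xs
eval (f ⊗ g)   xs = eval f xs ℚ.* eval g xs

_≈_ : SymFun → SymFun → Set
f ≈ g = ∀ (xs : List ℚ) → eval f xs ≡ eval g xs

StrictPartition : List ℕ → Set
StrictPartition la = Linked (λ a b → b < a) la × All (λ a → 0 < a) la

-- Shifted Young diagram: row i (1-based) has boxes (i, j), i ≤ j ≤ λ_i + i - 1.
shiftedRows : ℕ → List ℕ → List (ℕ × ℕ)
shiftedRows i []       = []
shiftedRows i (a ∷ as) = map (λ t → (i , i ℕ.+ t)) (upTo a) ++ shiftedRows (suc i) as

shifted : List ℕ → List (ℕ × ℕ)
shifted la = shiftedRows 1 la

-- content c = j - i  (nonnegative on shifted diagrams)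
content : ℕ × ℕ → ℕ
content (i , j) = j ∸ i

chat : ℕ × ℕ → ℚ
chat b = (+ (content b ℕ.* suc (content b))) / 2

toℚ : ℕ → ℚ
toℚ n = (+ n) / 1

IsHat : SymFun → SymFun → Set
IsHat F G = ∀ (la : List ℕ) → StrictPartition la →
  eval G (map toℚ la) ≡ eval F (map chat (shifted la))

-- The boxes in row i of S(λ) have contents 0, 1, …, λᵢ − 1, so
-- p_{r+1}(ĉ_□ : □ ∈ S(λ)) = Σᵢ P_r(λᵢ) with P_r(a) = Σ_{t<a} (t(t+1)/2)^{r+1}.
-- P_r is an odd polynomial: B_k(x) = ∏_{|j|≤k} (x − j) = x ∏_{j=1}^{k} (x² − j²) satisfies
-- B_k(c+1) − B_k(c) = (2k+1) C_k(c(c+1)) with C_k(c(c+1)) = ∏_{j=1-k}^{k} (c + j), i.e.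
-- C_k(m) = ∏_{j=1}^{k} (m − j(j−1)); the C_k form a basis of ℚ[m], so expanding
-- (m/2)^{r+1} = Σ_k a_k C_k(m) gives P_r = Σ_k a_k B_k / (2k+1), which vanishes at 0.
-- If P_r(x) = Σ_j c_j x^{2j+1} then p̂_{r+1} = Σ_j c_j p_{2j+1} ∈ Γ, and F̂ is F with each
-- p_{r+1} replaced by p̂_{r+1}.
--
-- Uniqueness holds in all of Λ. A symmetric function
-- evaluated at ys ++ y ∷ λ is a polynomial in y, and y ∷ λ is strict for all integers
-- y > λ₁; a polynomial is determined by its values at infinitely many integers, so
-- agreement on all strict partitions propagates, one variable at a time, to all lists.

module Submission where

open import Defs
open import Level using (0ℓ)
open import Function using (_∘_)
open import Data.Nat as ℕ using (ℕ; zero; suc; _∸_; _⊔_; z≤n; s≤s)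
import Data.Nat.Properties as ℕ
open import Data.Integer as ℤ using (+_)
import Data.Integer.Properties as ℤ
open import Data.Integer.Tactic.RingSolver as ℤ-Solver using ()
open import Data.Rational as ℚ using (ℚ; 0ℚ; 1ℚ; ½; _+_; _*_; _-_; -_; 1/_; fromℚᵘ; toℚᵘ)
open import Data.Rational.Properties
import Data.Rational.Unnormalised as ℚᵘ
import Data.Rational.Unnormalised.Properties as ℚᵘ
open import Relation.Nullary.Decidable using (dec⇒maybe)
open import Data.Product using (Σ; ∃; _×_; _,_)
open import Data.List using (List; []; _∷_; [_]; map; _++_; upTo; _∷ʳ_)
open import Data.List.Properties using (map-++; map-∘; ++-assoc; upTo-∷ʳ)
open import Data.List.Relation.Unary.All using ([]; _∷_)
open import Data.List.Relation.Unary.Linked using ([]; [-]; _∷_)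
open import Relation.Binary.PropositionalEquality hiding ([_])
open import Tactic.RingSolver.Core.AlmostCommutativeRing using (AlmostCommutativeRing; fromCommutativeRing)
open import Tactic.RingSolver using (solve-∀)
open import Algebra.Definitions (_≡_ {A = ℚ}) using (AlmostLeftCancellative)
open import Algebra.Properties.Group +-0-group using (x∙y⁻¹≈ε⇒x≈y; quasigroup)
open import Algebra.Properties.Quasigroup quasigroup using () renaming (cancelˡ to +-cancelˡ)

ℚ-ring : AlmostCommutativeRing 0ℓ 0ℓ
ℚ-ring = fromCommutativeRing +-*-commutativeRing (λ x → dec⇒maybe (0ℚ ≟ x))

fromℚᵘ-homo-+ : ∀ p q → fromℚᵘ (p ℚᵘ.+ q) ≡ fromℚᵘ p + fromℚᵘ q
fromℚᵘ-homo-+ p q = toℚᵘ-injective (begin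
  toℚᵘ (fromℚᵘ (p ℚᵘ.+ q))               ≈⟨ toℚᵘ-fromℚᵘ (p ℚᵘ.+ q) ⟩
  p ℚᵘ.+ q                                ≈⟨ ℚᵘ.+-cong (toℚᵘ-fromℚᵘ p) (toℚᵘ-fromℚᵘ q) ⟨
  toℚᵘ (fromℚᵘ p) ℚᵘ.+ toℚᵘ (fromℚᵘ q)   ≈⟨ toℚᵘ-homo-+ (fromℚᵘ p) (fromℚᵘ q) ⟨
  toℚᵘ (fromℚᵘ p + fromℚᵘ q)              ∎)
  where open ℚᵘ.≃-Reasoning

fromℚᵘ-homo-* : ∀ p q → fromℚᵘ (p ℚᵘ.* q) ≡ fromℚᵘ p * fromℚᵘ q
fromℚᵘ-homo-* p q = toℚᵘ-injective (begin
  toℚᵘ (fromℚᵘ (p ℚᵘ.* q))               ≈⟨ toℚᵘ-fromℚᵘ (p ℚᵘ.* q) ⟩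
  p ℚᵘ.* q                                ≈⟨ ℚᵘ.*-cong (toℚᵘ-fromℚᵘ p) (toℚᵘ-fromℚᵘ q) ⟨
  toℚᵘ (fromℚᵘ p) ℚᵘ.* toℚᵘ (fromℚᵘ q)   ≈⟨ toℚᵘ-homo-* (fromℚᵘ p) (fromℚᵘ q) ⟨
  toℚᵘ (fromℚᵘ p * fromℚᵘ q)              ∎)
  where open ℚᵘ.≃-Reasoning

*-almostCancelˡ : AlmostLeftCancellative 0ℚ _*_
*-almostCancelˡ p q r p≢0 pq≡pr = begin
  q               ≡⟨ *-identityˡ q ⟨
  1ℚ * q          ≡⟨ cong (_* q) (*-inverseˡ p) ⟨
  1/ p * p * q    ≡⟨ *-assoc (1/ p) p q ⟩
  1/ p * (p * q)  ≡⟨ cong (1/ p *_) pq≡pr ⟩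
  1/ p * (p * r)  ≡⟨ *-assoc (1/ p) p r ⟨
  1/ p * p * r    ≡⟨ cong (_* r) (*-inverseˡ p) ⟩
  1ℚ * r          ≡⟨ *-identityˡ r ⟩
  r               ∎
  where
  open ≡-Reasoning
  instance
    p-nonZero : ℚ.NonZero p
    p-nonZero = ℚ.≢-nonZero p≢0

-- By definition toℚ n = fromℚᵘ (mkℚᵘ (+ n) 0) and (+ n) / 2 = fromℚᵘ (mkℚᵘ (+ n) 1),
-- so identities between them are checked on unnormalised representatives.

toℚ-+ : ∀ m n → toℚ (m ℕ.+ n) ≡ toℚ m + toℚ n
toℚ-+ m n = trans (fromℚᵘ-cong {ℚᵘ.mkℚᵘ (+ (m ℕ.+ n)) 0} {ℚᵘ.mkℚᵘ (+ m) 0 ℚᵘ.+ ℚᵘ.mkℚᵘ (+ n) 0} (ℚᵘ.*≡* eq))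
                  (fromℚᵘ-homo-+ (ℚᵘ.mkℚᵘ (+ m) 0) (ℚᵘ.mkℚᵘ (+ n) 0))
  where
  identity : ∀ a b → (a ℤ.+ b) ℤ.* + 1 ≡ (a ℤ.* + 1 ℤ.+ b ℤ.* + 1) ℤ.* + 1
  identity = ℤ-Solver.solve-∀
  eq : + (m ℕ.+ n) ℤ.* + 1 ≡ (+ m ℤ.* + 1 ℤ.+ + n ℤ.* + 1) ℤ.* + 1
  eq = trans (cong (ℤ._* + 1) (ℤ.pos-+ m n)) (identity (+ m) (+ n))

toℚ-* : ∀ m n → toℚ (m ℕ.* n) ≡ toℚ m * toℚ n
toℚ-* m n = trans (fromℚᵘ-cong {ℚᵘ.mkℚᵘ (+ (m ℕ.* n)) 0} {ℚᵘ.mkℚᵘ (+ m) 0 ℚᵘ.* ℚᵘ.mkℚᵘ (+ n) 0} (ℚᵘ.*≡* eq))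
                  (fromℚᵘ-homo-* (ℚᵘ.mkℚᵘ (+ m) 0) (ℚᵘ.mkℚᵘ (+ n) 0))
  where
  eq : + (m ℕ.* n) ℤ.* + 1 ≡ (+ m ℤ.* + n) ℤ.* + 1
  eq = cong (ℤ._* + 1) (ℤ.pos-* m n)

toℚ-suc : ∀ n → toℚ (suc n) ≡ toℚ n + 1ℚ
toℚ-suc n = trans (toℚ-+ 1 n) (+-comm 1ℚ (toℚ n))

toℚ-injective : ∀ {m n} → toℚ m ≡ toℚ n → m ≡ n
toℚ-injective {m} {n} eq with fromℚᵘ-injective {ℚᵘ.mkℚᵘ (+ m) 0} {ℚᵘ.mkℚᵘ (+ n) 0} eq
... | ℚᵘ.*≡* e = ℤ.+-injective (trans (sym (ℤ.*-identityʳ (+ m))) (trans e (ℤ.*-identityʳ (+ n))))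

n/2≡toℚn*½ : ∀ n → (+ n) ℚ./ 2 ≡ toℚ n * ½
n/2≡toℚn*½ n = trans (fromℚᵘ-cong {ℚᵘ.mkℚᵘ (+ n) 1} {ℚᵘ.mkℚᵘ (+ n) 0 ℚᵘ.* ℚᵘ.mkℚᵘ (+ 1) 1} (ℚᵘ.*≡* eq))
                     (fromℚᵘ-homo-* (ℚᵘ.mkℚᵘ (+ n) 0) (ℚᵘ.mkℚᵘ (+ 1) 1))
  where
  eq : + n ℤ.* + 2 ≡ (+ n ℤ.* + 1) ℤ.* + 2
  eq = cong (ℤ._* + 2) (sym (ℤ.*-identityʳ (+ n)))

m<n⇒toℚn-toℚm≢0 : ∀ {m n} → m ℕ.< n → toℚ n - toℚ m ≢ 0ℚ
m<n⇒toℚn-toℚm≢0 m<n eq = ℕ.<-irrefl (sym (toℚ-injective (x∙y⁻¹≈ε⇒x≈y _ _ eq))) m<n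

toℚ-suc-nonZero : ∀ n → ℚ.NonZero (toℚ (suc n))
toℚ-suc-nonZero n = ℚ.≢-nonZero (λ eq → ℕ.0≢1+n (sym (toℚ-injective {suc n} {0} eq)))

sumℚ-++ : ∀ xs ys → sumℚ (xs ++ ys) ≡ sumℚ xs + sumℚ ys
sumℚ-++ []       ys = sym (+-identityˡ (sumℚ ys))
sumℚ-++ (x ∷ xs) ys = trans (cong (_+_ x) (sumℚ-++ xs ys)) (sym (+-assoc x (sumℚ xs) (sumℚ ys)))

sumℚ-map-0 : ∀ {A : Set} (xs : List A) → sumℚ (map (λ _ → 0ℚ) xs) ≡ 0ℚ
sumℚ-map-0 []       = refl
sumℚ-map-0 (x ∷ xs) = trans (+-identityˡ _) (sumℚ-map-0 xs)

sumℚ-map-+ : ∀ {A : Set} (f g : A → ℚ) xs →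
             sumℚ (map (λ x → f x + g x) xs) ≡ sumℚ (map f xs) + sumℚ (map g xs)
sumℚ-map-+ f g []       = refl
sumℚ-map-+ f g (x ∷ xs) =
  trans (cong (_+_ (f x + g x)) (sumℚ-map-+ f g xs)) (interchange (f x) (g x) _ _)
  where
  interchange : ∀ a b c d → a + b + (c + d) ≡ a + c + (b + d)
  interchange = solve-∀ ℚ-ring

sumℚ-map-* : ∀ {A : Set} c (f : A → ℚ) xs → sumℚ (map (λ x → c * f x) xs) ≡ c * sumℚ (map f xs)
sumℚ-map-* c f []       = sym (*-zeroʳ c)
sumℚ-map-* c f (x ∷ xs) =
  trans (cong (_+_ (c * f x)) (sumℚ-map-* c f xs)) (sym (*-distribˡ-+ c (f x) _))

sumℚ-telescope : ∀ (f : ℕ → ℚ) (Q : ℕ → ℚ) → (∀ t → f t ≡ Q (suc t) - Q t) →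
                 ∀ a → sumℚ (map f (upTo a)) ≡ Q a - Q 0
sumℚ-telescope f Q step zero    = sym (+-inverseʳ (Q 0))
sumℚ-telescope f Q step (suc a) = begin
  sumℚ (map f (upTo (suc a)))                  ≡⟨ cong (sumℚ ∘ map f) (upTo-∷ʳ a) ⟨
  sumℚ (map f (upTo a ∷ʳ a))                   ≡⟨ cong sumℚ (map-++ f (upTo a) [ a ]) ⟩
  sumℚ (map f (upTo a) ++ [ f a ])             ≡⟨ sumℚ-++ (map f (upTo a)) [ f a ] ⟩
  sumℚ (map f (upTo a)) + (f a + 0ℚ)           ≡⟨ cong₂ (λ s t → s + (t + 0ℚ)) (sumℚ-telescope f Q step a) (step a) ⟩
  Q a - Q 0 + (Q (suc a) - Q a + 0ℚ)           ≡⟨ cancel (Q 0) (Q a) (Q (suc a)) ⟩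
  Q (suc a) - Q 0                              ∎
  where
  open ≡-Reasoning
  cancel : ∀ q₀ qₐ q → qₐ - q₀ + (q - qₐ + 0ℚ) ≡ q - q₀
  cancel = solve-∀ ℚ-ring

powerSum-++ : ∀ r xs ys → powerSum r (xs ++ ys) ≡ powerSum r xs + powerSum r ys
powerSum-++ r xs ys = trans (cong sumℚ (map-++ power xs ys)) (sumℚ-++ (map power xs) (map power ys))
  where
  power : ℚ → ℚ
  power x = pow x (suc r)

-- Polynomial functions of bounded degree

Deg≤ : ℕ → (ℚ → ℚ) → Set
Deg≤ zero    g = ∀ x → g x ≡ g 0ℚ
Deg≤ (suc d) g = ∀ a → Σ (ℚ → ℚ) λ h → Deg≤ d h × (∀ x → g x ≡ g a + (x - a) * h x)

x≡x+y*0 : ∀ x y → x ≡ x + y * 0ℚ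
x≡x+y*0 = solve-∀ ℚ-ring

Deg≤-ext : ∀ d {f g} → f ≗ g → Deg≤ d f → Deg≤ d g
Deg≤-ext zero    f≗g Df x = trans (sym (f≗g x)) (trans (Df x) (f≗g 0ℚ))
Deg≤-ext (suc d) f≗g Df a =
  let h , Dh , f≡ = Df a
  in  h , Dh , λ x → trans (sym (f≗g x)) (trans (f≡ x) (cong (λ c → c + (x - a) * h x) (f≗g a)))

Deg≤-const : ∀ d c → Deg≤ d (λ _ → c)
Deg≤-const zero    c x = refl
Deg≤-const (suc d) c a = (λ _ → 0ℚ) , Deg≤-const d 0ℚ , λ x → x≡x+y*0 c (x - a)

Deg≤-mono : ∀ {m n g} → m ℕ.≤ n → Deg≤ m g → Deg≤ n g
Deg≤-mono {n = n} {g} z≤n Dg = Deg≤-ext n (λ x → sym (Dg x)) (Deg≤-const n (g 0ℚ))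
Deg≤-mono (s≤s m≤n) Dg a = let h , Dh , g≡ = Dg a in h , Deg≤-mono m≤n Dh , g≡

Deg≤-factor : ∀ e {g} → Deg≤ e g → ∀ a →
              Σ (ℚ → ℚ) λ h → Deg≤ (e ∸ 1) h × (∀ x → g x ≡ g a + (x - a) * h x)
Deg≤-factor zero {g} Dg a =
  (λ _ → 0ℚ) , (λ _ → refl) , λ x → trans (Dg x) (trans (sym (Dg a)) (x≡x+y*0 (g a) (x - a)))
Deg≤-factor (suc e) Dg = Dg

Deg≤-+ : ∀ d {f g} → Deg≤ d f → Deg≤ d g → Deg≤ d (λ x → f x + g x)
Deg≤-+ zero    Df Dg x = cong₂ _+_ (Df x) (Dg x)
Deg≤-+ (suc d) {f} {g} Df Dg a =
  let hf , Dhf , f≡ = Df a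
      hg , Dhg , g≡ = Dg a
  in  (λ x → hf x + hg x) , Deg≤-+ d Dhf Dhg ,
      λ x → trans (cong₂ _+_ (f≡ x) (g≡ x)) (collect (f a) (g a) (x - a) (hf x) (hg x))
  where
  collect : ∀ A B y P Q → A + y * P + (B + y * Q) ≡ A + B + y * (P + Q)
  collect = solve-∀ ℚ-ring

Deg≤-scale : ∀ d c {g} → Deg≤ d g → Deg≤ d (λ x → c * g x)
Deg≤-scale zero    c Dg x = cong (c *_) (Dg x)
Deg≤-scale (suc d) c {g} Dg a =
  let h , Dh , g≡ = Dg a
  in  (λ x → c * h x) , Deg≤-scale d c Dh ,
      λ x → trans (cong (c *_) (g≡ x)) (distrib c (g a) (x - a) (h x))
  where
  distrib : ∀ c A y P → c * (A + y * P) ≡ c * A + y * (c * P)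
  distrib = solve-∀ ℚ-ring

Deg≤-* : ∀ d e {f g} → Deg≤ d f → Deg≤ e g → Deg≤ (d ℕ.+ e) (λ x → f x * g x)
Deg≤-* zero    e {f} {g} Df Dg =
  Deg≤-ext e (λ x → cong (_* g x) (sym (Df x))) (Deg≤-scale e (f 0ℚ) Dg)
Deg≤-* (suc d) e {f} {g} Df Dg a =
  let hf , Dhf , f≡ = Df a
      hg , Dhg , g≡ = Deg≤-factor e Dg a
  in  (λ x → hf x * g x + f a * hg x) ,
      Deg≤-+ (d ℕ.+ e) (Deg≤-* d e Dhf Dg) (Deg≤-mono e∸1≤d+e (Deg≤-scale (e ∸ 1) (f a) Dhg)) ,
      λ x → begin
        f x * g x                                        ≡⟨ cong (_* g x) (f≡ x) ⟩
        (f a + (x - a) * hf x) * g x                     ≡⟨ split (f a) (x - a) (hf x) (g x) ⟩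
        f a * g x + (x - a) * (hf x * g x)               ≡⟨ cong (λ t → f a * t + (x - a) * (hf x * g x)) (g≡ x) ⟩
        f a * (g a + (x - a) * hg x) + (x - a) * (hf x * g x) ≡⟨ regroup (f a) (g a) (x - a) (hg x) (hf x * g x) ⟩
        f a * g a + (x - a) * (hf x * g x + f a * hg x)  ∎
  where
  open ≡-Reasoning
  e∸1≤d+e : e ∸ 1 ℕ.≤ d ℕ.+ e
  e∸1≤d+e = ℕ.≤-trans (ℕ.m∸n≤m e 1) (ℕ.m≤n+m e d)
  split : ∀ A y H G → (A + y * H) * G ≡ A * G + y * (H * G)
  split = solve-∀ ℚ-ring
  regroup : ∀ A B y K R → A * (B + y * K) + y * R ≡ A * B + y * (R + A * K)
  regroup = solve-∀ ℚ-ring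

Deg≤-id : Deg≤ 1 (λ x → x)
Deg≤-id a = (λ _ → 1ℚ) , (λ _ → refl) , λ x → x≡a+[x-a]*1 x a
  where
  x≡a+[x-a]*1 : ∀ x a → x ≡ a + (x - a) * 1ℚ
  x≡a+[x-a]*1 = solve-∀ ℚ-ring

Deg≤-pow : ∀ k → Deg≤ k (λ x → pow x k)
Deg≤-pow zero    x = refl
Deg≤-pow (suc k) = Deg≤-* 1 k Deg≤-id (Deg≤-pow k)

Deg≤-agree : ∀ d {f g} M → Deg≤ d f → Deg≤ d g →
             (∀ n → M ℕ.≤ n → f (toℚ n) ≡ g (toℚ n)) → f ≗ g
Deg≤-agree zero {f} {g} M Df Dg f≡g x = begin
  f x          ≡⟨ Df x ⟩
  f 0ℚ         ≡⟨ Df (toℚ M) ⟨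
  f (toℚ M)    ≡⟨ f≡g M ℕ.≤-refl ⟩
  g (toℚ M)    ≡⟨ Dg (toℚ M) ⟩
  g 0ℚ         ≡⟨ Dg x ⟨
  g x          ∎
  where open ≡-Reasoning
Deg≤-agree (suc d) {f} {g} M Df Dg f≡g x with Df (toℚ M) | Dg (toℚ M)
... | hf , Dhf , f≡ | hg , Dhg , g≡ = begin
  f x                   ≡⟨ f≡ x ⟩
  f a + (x - a) * hf x  ≡⟨ cong₂ (λ c h → c + (x - a) * h) fa≡ga (Deg≤-agree d (suc M) Dhf Dhg hf≡hg x) ⟩
  g a + (x - a) * hg x  ≡⟨ g≡ x ⟨
  g x                   ∎
  where
  open ≡-Reasoning
  a = toℚ M
  fa≡ga : f a ≡ g a
  fa≡ga = f≡g M ℕ.≤-refl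
  hf≡hg : ∀ n → suc M ℕ.≤ n → hf (toℚ n) ≡ hg (toℚ n)
  hf≡hg n M<n = *-almostCancelˡ (toℚ n - a) _ _ (m<n⇒toℚn-toℚm≢0 M<n) (+-cancelˡ (f a) _ _ (begin
    f a + (toℚ n - a) * hf (toℚ n)  ≡⟨ f≡ (toℚ n) ⟨
    f (toℚ n)                       ≡⟨ f≡g n (ℕ.<⇒≤ M<n) ⟩
    g (toℚ n)                       ≡⟨ g≡ (toℚ n) ⟩
    g a + (toℚ n - a) * hg (toℚ n)  ≡⟨ cong (λ c → c + (toℚ n - a) * hg (toℚ n)) fa≡ga ⟨
    f a + (toℚ n - a) * hg (toℚ n)  ∎))

-- Uniqueness

eval-Deg≤ : ∀ G → ∃ λ d → ∀ ys zs → Deg≤ d (λ z → eval G (ys ++ z ∷ zs))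
eval-Deg≤ (const q) = 0 , λ ys zs x → refl
eval-Deg≤ (psuc r)  = suc r , λ ys zs →
  Deg≤-ext (suc r) (λ z → sym (powerSum-++ r ys (z ∷ zs)))
    (Deg≤-+ (suc r) (Deg≤-const (suc r) (powerSum r ys))
      (Deg≤-+ (suc r) (Deg≤-pow (suc r)) (Deg≤-const (suc r) (powerSum r zs))))
eval-Deg≤ (f ⊕ g) =
  let d₁ , D₁ = eval-Deg≤ f
      d₂ , D₂ = eval-Deg≤ g
  in  d₁ ⊔ d₂ , λ ys zs →
      Deg≤-+ (d₁ ⊔ d₂) (Deg≤-mono (ℕ.m≤m⊔n d₁ d₂) (D₁ ys zs)) (Deg≤-mono (ℕ.m≤n⊔m d₁ d₂) (D₂ ys zs))
eval-Deg≤ (f ⊗ g) =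
  let d₁ , D₁ = eval-Deg≤ f
      d₂ , D₂ = eval-Deg≤ g
  in  d₁ ℕ.+ d₂ , λ ys zs → Deg≤-* d₁ d₂ (D₁ ys zs) (D₂ ys zs)

strict-extend : ∀ {la} → StrictPartition la → ∃ λ M → ∀ n → M ℕ.≤ n → StrictPartition (n ∷ la)
strict-extend {[]}    _          = 1 , λ n 0<n → [-] , 0<n ∷ []
strict-extend {b ∷ _} (lk , pos) = suc b , λ n b<n → b<n ∷ lk , ℕ.≤-trans (s≤s z≤n) b<n ∷ pos

AgreeOnStrictAfter : SymFun → SymFun → List ℚ → Set
AgreeOnStrictAfter G G′ ys =
  ∀ la → StrictPartition la → eval G (ys ++ map toℚ la) ≡ eval G′ (ys ++ map toℚ la)

agreeOnStrictAfter-∷ʳ : ∀ G G′ ys y → AgreeOnStrictAfter G G′ ys → AgreeOnStrictAfter G G′ (ys ∷ʳ y)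
agreeOnStrictAfter-∷ʳ G G′ ys y agree la sp =
  let d  , D      = eval-Deg≤ G
      d′ , D′     = eval-Deg≤ G′
      M  , extend = strict-extend sp
      ℓ           = map toℚ la
  in  subst (λ zs → eval G zs ≡ eval G′ zs) (sym (++-assoc ys [ y ] ℓ))
        (Deg≤-agree (d ⊔ d′) M (Deg≤-mono (ℕ.m≤m⊔n d d′) (D ys ℓ)) (Deg≤-mono (ℕ.m≤n⊔m d d′) (D′ ys ℓ))
          (λ n M≤n → agree (n ∷ la) (extend n M≤n)) y)

agreeOnStrictAfter⇒agree : ∀ G G′ xs ys → AgreeOnStrictAfter G G′ ys → eval G (ys ++ xs) ≡ eval G′ (ys ++ xs)
agreeOnStrictAfter⇒agree G G′ []       ys agree = agree [] ([] , [])
agreeOnStrictAfter⇒agree G G′ (x ∷ xs) ys agree =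
  subst (λ zs → eval G zs ≡ eval G′ zs) (++-assoc ys [ x ] xs)
    (agreeOnStrictAfter⇒agree G G′ xs (ys ∷ʳ x) (agreeOnStrictAfter-∷ʳ G G′ ys x agree))

isHat-unique : ∀ F G G′ → IsHat F G → IsHat F G′ → G′ ≈ G
isHat-unique F G G′ hat hat′ xs =
  agreeOnStrictAfter⇒agree G′ G xs [] (λ la sp → trans (hat′ la sp) (sym (hat la sp)))

-- Expansions in a basis

expand : (ℕ → ℚ → ℚ) → ℕ → List ℚ → ℚ → ℚ
expand b k []       x = 0ℚ
expand b k (c ∷ cs) x = c * b k x + expand b (suc k) cs x

infixl 6 _⊞_
_⊞_ : List ℚ → List ℚ → List ℚ
[]       ⊞ ds       = ds
(c ∷ cs) ⊞ []       = c ∷ cs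
(c ∷ cs) ⊞ (d ∷ ds) = c + d ∷ cs ⊞ ds

expand-⊞ : ∀ b k cs ds x → expand b k (cs ⊞ ds) x ≡ expand b k cs x + expand b k ds x
expand-⊞ b k []       ds       x = sym (+-identityˡ _)
expand-⊞ b k (c ∷ cs) []       x = sym (+-identityʳ _)
expand-⊞ b k (c ∷ cs) (d ∷ ds) x =
  trans (cong (_+_ ((c + d) * b k x)) (expand-⊞ b (suc k) cs ds x)) (interchange c d (b k x) _ _)
  where
  interchange : ∀ c d y e f → (c + d) * y + (e + f) ≡ c * y + e + (d * y + f)
  interchange = solve-∀ ℚ-ring

scale : ℚ → List ℚ → List ℚ
scale q = map (q *_)

expand-scale : ∀ b k q cs x → expand b k (scale q cs) x ≡ q * expand b k cs x
expand-scale b k q []       x = sym (*-zeroʳ q)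
expand-scale b k q (c ∷ cs) x =
  trans (cong (_+_ (q * c * b k x)) (expand-scale b (suc k) q cs x)) (factor q c (b k x) _)
  where
  factor : ∀ q c y e → q * c * y + q * e ≡ q * (c * y + e)
  factor = solve-∀ ℚ-ring

MulRecurrence : (ℕ → ℚ → ℚ) → (ℚ → ℚ) → (ℕ → ℚ) → Set
MulRecurrence b v w = ∀ k x → v x * b k x ≡ b (suc k) x + w k * b k x

mulByVariable : (ℕ → ℚ) → ℕ → List ℚ → List ℚ
mulByVariable w k []       = []
mulByVariable w k (c ∷ cs) = w k * c ∷ [ c ] ⊞ mulByVariable w (suc k) cs

expand-mulByVariable : ∀ {b v w} → MulRecurrence b v w →
                       ∀ k cs x → expand b k (mulByVariable w k cs) x ≡ v x * expand b k cs x
expand-mulByVariable {v = v} rec k []       x = sym (*-zeroʳ (v x))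
expand-mulByVariable {b} {v} {w} rec k (c ∷ cs) x = begin
  w k * c * b k x + expand b (suc k) ([ c ] ⊞ mulByVariable w (suc k) cs) x
    ≡⟨ cong (_+_ (w k * c * b k x)) (expand-⊞ b (suc k) [ c ] (mulByVariable w (suc k) cs) x) ⟩
  w k * c * b k x + (c * b (suc k) x + 0ℚ + expand b (suc k) (mulByVariable w (suc k) cs) x)
    ≡⟨ cong (λ e → w k * c * b k x + (c * b (suc k) x + 0ℚ + e)) (expand-mulByVariable {v = v} rec (suc k) cs x) ⟩
  w k * c * b k x + (c * b (suc k) x + 0ℚ + v x * E)
    ≡⟨ regroup (w k) c (b k x) (b (suc k) x) (v x) E ⟩
  c * (b (suc k) x + w k * b k x) + v x * E
    ≡⟨ cong (λ t → c * t + v x * E) (rec k x) ⟨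
  c * (v x * b k x) + v x * E
    ≡⟨ factor c (v x) (b k x) E ⟩
  v x * (c * b k x + E) ∎
  where
  open ≡-Reasoning
  E = expand b (suc k) cs x
  regroup : ∀ w c B B′ V E → w * c * B + (c * B′ + 0ℚ + V * E) ≡ c * (B′ + w * B) + V * E
  regroup = solve-∀ ℚ-ring
  factor : ∀ c V B E → c * (V * B) + V * E ≡ V * (c * B + E)
  factor = solve-∀ ℚ-ring

-- Odd antidifferences of polynomials in c (c + 1)

oddPower : ℕ → ℚ → ℚ
oddPower k x = pow x (suc (k ℕ.+ k))

oddPoly : List ℚ → ℚ → ℚ
oddPoly = expand oddPower 0

oddPower-recurrence : ∀ s → MulRecurrence oddPower (λ x → x * x - s) (λ _ → - s)
oddPower-recurrence s k x rewrite ℕ.+-suc k k = shift x s (oddPower k x)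
  where
  shift : ∀ x s P → (x * x - s) * P ≡ x * (x * P) + - s * P
  shift = solve-∀ ℚ-ring

expand-oddPower-0 : ∀ k cs → expand oddPower k cs 0ℚ ≡ 0ℚ
expand-oddPower-0 k []       = refl
expand-oddPower-0 k (c ∷ cs) =
  cong₂ _+_ (trans (cong (c *_) (*-zeroˡ (pow 0ℚ (k ℕ.+ k)))) (*-zeroʳ c)) (expand-oddPower-0 (suc k) cs)

C : ℕ → ℚ → ℚ
C zero    m = 1ℚ
C (suc k) m = C k m * (m - toℚ (suc k) * toℚ k)

C-recurrence : MulRecurrence C (λ m → m) (λ k → toℚ (suc k) * toℚ k)
C-recurrence k m = shift m (C k m) (toℚ (suc k) * toℚ k)
  where
  shift : ∀ m P t → m * P ≡ P * (m - t) + t * P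
  shift = solve-∀ ℚ-ring

halfPowerCoeffs : ℕ → List ℚ
halfPowerCoeffs zero    = [ 1ℚ ]
halfPowerCoeffs (suc r) = scale ½ (mulByVariable (λ k → toℚ (suc k) * toℚ k) 0 (halfPowerCoeffs r))

expand-halfPowerCoeffs : ∀ r m → expand C 0 (halfPowerCoeffs r) m ≡ pow (m * ½) r
expand-halfPowerCoeffs zero    m = refl
expand-halfPowerCoeffs (suc r) m = begin
  expand C 0 (scale ½ (mulByVariable _ 0 (halfPowerCoeffs r))) m
    ≡⟨ expand-scale C 0 ½ (mulByVariable _ 0 (halfPowerCoeffs r)) m ⟩
  ½ * expand C 0 (mulByVariable _ 0 (halfPowerCoeffs r)) m
    ≡⟨ cong (½ *_) (expand-mulByVariable {v = λ m → m} C-recurrence 0 (halfPowerCoeffs r) m) ⟩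
  ½ * (m * expand C 0 (halfPowerCoeffs r) m)
    ≡⟨ cong (λ p → ½ * (m * p)) (expand-halfPowerCoeffs r m) ⟩
  ½ * (m * pow (m * ½) r)
    ≡⟨ reassoc ½ m (pow (m * ½) r) ⟩
  m * ½ * pow (m * ½) r ∎
  where
  open ≡-Reasoning
  reassoc : ∀ h m p → h * (m * p) ≡ m * h * p
  reassoc = solve-∀ ℚ-ring

B : ℕ → ℚ → ℚ
B zero    x = x
B (suc k) x = B k x * (x * x - toℚ (suc k) * toℚ (suc k))

BCoeffs : ℕ → List ℚ
BCoeffs zero    = [ 1ℚ ]
BCoeffs (suc k) = mulByVariable (λ _ → - (toℚ (suc k) * toℚ (suc k))) 0 (BCoeffs k)

oddPoly-BCoeffs : ∀ k x → oddPoly (BCoeffs k) x ≡ B k x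
oddPoly-BCoeffs zero    x = 1*[x*1]+0≡x x
  where
  1*[x*1]+0≡x : ∀ x → 1ℚ * (x * 1ℚ) + 0ℚ ≡ x
  1*[x*1]+0≡x = solve-∀ ℚ-ring
oddPoly-BCoeffs (suc k) x = begin
  oddPoly (mulByVariable (λ _ → - s) 0 (BCoeffs k)) x
    ≡⟨ expand-mulByVariable {v = λ x → x * x - s} (oddPower-recurrence s) 0 (BCoeffs k) x ⟩
  (x * x - s) * oddPoly (BCoeffs k) x
    ≡⟨ cong ((x * x - s) *_) (oddPoly-BCoeffs k x) ⟩
  (x * x - s) * B k x
    ≡⟨ *-comm (x * x - s) (B k x) ⟩
  B k x * (x * x - s) ∎
  where
  open ≡-Reasoning
  s = toℚ (suc k) * toℚ (suc k)

B-factor-c+1 : ∀ k c → B k (c + 1ℚ) ≡ C k (c * (c + 1ℚ)) * (c + 1ℚ + toℚ k)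
B-factor-c+1 zero    c = sym (trans (*-identityˡ (c + 1ℚ + 0ℚ)) (+-identityʳ (c + 1ℚ)))
B-factor-c+1 (suc k) c rewrite B-factor-c+1 k c | toℚ-suc k = identity (C k (c * (c + 1ℚ))) c (toℚ k)
  where
  identity : ∀ P c K → P * (c + 1ℚ + K) * ((c + 1ℚ) * (c + 1ℚ) - (K + 1ℚ) * (K + 1ℚ))
                     ≡ P * (c * (c + 1ℚ) - (K + 1ℚ) * K) * (c + 1ℚ + (K + 1ℚ))
  identity = solve-∀ ℚ-ring

B-factor-c : ∀ k c → B k c ≡ C k (c * (c + 1ℚ)) * (c - toℚ k)
B-factor-c zero    c = sym (trans (*-identityˡ (c - 0ℚ)) (+-identityʳ c))
B-factor-c (suc k) c rewrite B-factor-c k c | toℚ-suc k = identity (C k (c * (c + 1ℚ))) c (toℚ k)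
  where
  identity : ∀ P c K → P * (c - K) * (c * c - (K + 1ℚ) * (K + 1ℚ))
                     ≡ P * (c * (c + 1ℚ) - (K + 1ℚ) * K) * (c - (K + 1ℚ))
  identity = solve-∀ ℚ-ring

B-difference : ∀ k c → B k (c + 1ℚ) - B k c ≡ toℚ (suc (k ℕ.+ k)) * C k (c * (c + 1ℚ))
B-difference k c rewrite B-factor-c+1 k c | B-factor-c k c | toℚ-suc (k ℕ.+ k) | toℚ-+ k k =
  identity (C k (c * (c + 1ℚ))) c (toℚ k)
  where
  identity : ∀ P c K → P * (c + 1ℚ + K) - P * (c - K) ≡ (K + K + 1ℚ) * P
  identity = solve-∀ ℚ-ring

oddInverse : ℕ → ℚ
oddInverse k = (1/ toℚ (suc (k ℕ.+ k))) {{toℚ-suc-nonZero (k ℕ.+ k)}}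

oddInverse-inverse : ∀ k → oddInverse k * toℚ (suc (k ℕ.+ k)) ≡ 1ℚ
oddInverse-inverse k = *-inverseˡ (toℚ (suc (k ℕ.+ k))) {{toℚ-suc-nonZero (k ℕ.+ k)}}

antidifference : ℕ → List ℚ → List ℚ
antidifference k []       = []
antidifference k (a ∷ as) = scale (a * oddInverse k) (BCoeffs k) ⊞ antidifference (suc k) as

oddPoly-antidifference-∷ : ∀ k a as x →
  oddPoly (antidifference k (a ∷ as)) x ≡ a * oddInverse k * B k x + oddPoly (antidifference (suc k) as) x
oddPoly-antidifference-∷ k a as x = begin
  oddPoly (scale i (BCoeffs k) ⊞ antidifference (suc k) as) x
    ≡⟨ expand-⊞ oddPower 0 (scale i (BCoeffs k)) (antidifference (suc k) as) x ⟩
  oddPoly (scale i (BCoeffs k)) x + oddPoly (antidifference (suc k) as) x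
    ≡⟨ cong (_+ oddPoly (antidifference (suc k) as) x) (expand-scale oddPower 0 i (BCoeffs k) x) ⟩
  i * oddPoly (BCoeffs k) x + oddPoly (antidifference (suc k) as) x
    ≡⟨ cong (λ p → i * p + oddPoly (antidifference (suc k) as) x) (oddPoly-BCoeffs k x) ⟩
  i * B k x + oddPoly (antidifference (suc k) as) x ∎
  where
  open ≡-Reasoning
  i = a * oddInverse k

antidifference-Δ : ∀ k v c →
  oddPoly (antidifference k v) (c + 1ℚ) - oddPoly (antidifference k v) c ≡ expand C k v (c * (c + 1ℚ))
antidifference-Δ k []       c = refl
antidifference-Δ k (a ∷ as) c = begin
  oddPoly (antidifference k (a ∷ as)) (c + 1ℚ) - oddPoly (antidifference k (a ∷ as)) c
    ≡⟨ cong₂ _-_ (oddPoly-antidifference-∷ k a as (c + 1ℚ)) (oddPoly-antidifference-∷ k a as c) ⟩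
  a * i * B k (c + 1ℚ) + P₁ - (a * i * B k c + P₀)
    ≡⟨ regroup (a * i) (B k (c + 1ℚ)) (B k c) P₁ P₀ ⟩
  a * i * (B k (c + 1ℚ) - B k c) + (P₁ - P₀)
    ≡⟨ cong₂ (λ s t → a * i * s + t) (B-difference k c) (antidifference-Δ (suc k) as c) ⟩
  a * i * (toℚ (suc (k ℕ.+ k)) * C k m) + expand C (suc k) as m
    ≡⟨ cong (_+ expand C (suc k) as m) (reassoc a i (toℚ (suc (k ℕ.+ k))) (C k m)) ⟩
  a * (i * toℚ (suc (k ℕ.+ k))) * C k m + expand C (suc k) as m
    ≡⟨ cong (λ u → a * u * C k m + expand C (suc k) as m) (oddInverse-inverse k) ⟩
  a * 1ℚ * C k m + expand C (suc k) as m
    ≡⟨ cong (λ u → u * C k m + expand C (suc k) as m) (*-identityʳ a) ⟩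
  a * C k m + expand C (suc k) as m ∎
  where
  open ≡-Reasoning
  i  = oddInverse k
  m  = c * (c + 1ℚ)
  P₁ = oddPoly (antidifference (suc k) as) (c + 1ℚ)
  P₀ = oddPoly (antidifference (suc k) as) c
  regroup : ∀ u B₁ B₀ P₁ P₀ → u * B₁ + P₁ - (u * B₀ + P₀) ≡ u * (B₁ - B₀) + (P₁ - P₀)
  regroup = solve-∀ ℚ-ring
  reassoc : ∀ a i t C → a * i * (t * C) ≡ a * (i * t) * C
  reassoc = solve-∀ ℚ-ring

powerAntidifference : ℕ → List ℚ
powerAntidifference r = antidifference 0 (halfPowerCoeffs (suc r))

powerAntidifference-Δ : ∀ r c →
  oddPoly (powerAntidifference r) (c + 1ℚ) - oddPoly (powerAntidifference r) c ≡ pow (c * (c + 1ℚ) * ½) (suc r)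
powerAntidifference-Δ r c =
  trans (antidifference-Δ 0 (halfPowerCoeffs (suc r)) c) (expand-halfPowerCoeffs (suc r) (c * (c + 1ℚ)))

-- Construction of F̂

chat-row : ∀ i t → chat (i , i ℕ.+ t) ≡ toℚ t * (toℚ t + 1ℚ) * ½
chat-row i t = begin
  chat (i , i ℕ.+ t)        ≡⟨ cong (λ c → + (c ℕ.* suc c) ℚ./ 2) (ℕ.m+n∸m≡n i t) ⟩
  + (t ℕ.* suc t) ℚ./ 2     ≡⟨ n/2≡toℚn*½ (t ℕ.* suc t) ⟩
  toℚ (t ℕ.* suc t) * ½     ≡⟨ cong (_* ½) (toℚ-* t (suc t)) ⟩
  toℚ t * toℚ (suc t) * ½   ≡⟨ cong (λ s → toℚ t * s * ½) (toℚ-suc t) ⟩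
  toℚ t * (toℚ t + 1ℚ) * ½  ∎
  where open ≡-Reasoning

powerSum-row : ∀ r i a →
  powerSum r (map chat (map (λ t → (i , i ℕ.+ t)) (upTo a))) ≡ oddPoly (powerAntidifference r) (toℚ a)
powerSum-row r i a = begin
  sumℚ (map power (map chat (map box (upTo a))))  ≡⟨ cong (sumℚ ∘ map power) (map-∘ (upTo a)) ⟨
  sumℚ (map power (map (chat ∘ box) (upTo a)))    ≡⟨ cong sumℚ (map-∘ (upTo a)) ⟨
  sumℚ (map (power ∘ chat ∘ box) (upTo a))        ≡⟨ sumℚ-telescope (power ∘ chat ∘ box) Q step a ⟩
  Q a - Q 0                                        ≡⟨ cong (λ q → Q a - q) (expand-oddPower-0 0 (powerAntidifference r)) ⟩
  Q a - 0ℚ                                         ≡⟨ +-identityʳ (Q a) ⟩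
  Q a                                              ∎
  where
  open ≡-Reasoning
  power : ℚ → ℚ
  power x = pow x (suc r)
  box : ℕ → ℕ × ℕ
  box t = i , i ℕ.+ t
  Q : ℕ → ℚ
  Q n = oddPoly (powerAntidifference r) (toℚ n)
  step : ∀ t → power (chat (box t)) ≡ Q (suc t) - Q t
  step t = begin
    power (chat (box t))                     ≡⟨ cong power (chat-row i t) ⟩
    power (toℚ t * (toℚ t + 1ℚ) * ½)        ≡⟨ powerAntidifference-Δ r (toℚ t) ⟨
    oddPoly (powerAntidifference r) (toℚ t + 1ℚ) - Q t ≡⟨ cong (λ x → oddPoly (powerAntidifference r) x - Q t) (toℚ-suc t) ⟨
    Q (suc t) - Q t                          ∎

powerSum-shiftedRows : ∀ r i la →
  powerSum r (map chat (shiftedRows i la)) ≡ sumℚ (map (oddPoly (powerAntidifference r) ∘ toℚ) la)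
powerSum-shiftedRows r i []       = refl
powerSum-shiftedRows r i (a ∷ as) = begin
  powerSum r (map chat (row ++ rest))                       ≡⟨ cong (powerSum r) (map-++ chat row rest) ⟩
  powerSum r (map chat row ++ map chat rest)                ≡⟨ powerSum-++ r (map chat row) (map chat rest) ⟩
  powerSum r (map chat row) + powerSum r (map chat rest)    ≡⟨ cong₂ _+_ (powerSum-row r i a) (powerSum-shiftedRows r (suc i) as) ⟩
  sumℚ (map (oddPoly (powerAntidifference r) ∘ toℚ) (a ∷ as)) ∎
  where
  open ≡-Reasoning
  row  = map (λ t → (i , i ℕ.+ t)) (upTo a)
  rest = shiftedRows (suc i) as

oddSymFun : ℕ → List ℚ → SymFun
oddSymFun k []       = const 0ℚ
oddSymFun k (c ∷ cs) = (const c ⊗ psuc (k ℕ.+ k)) ⊕ oddSymFun (suc k) cs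

oddSymFun-Γ : ∀ k cs → InΓ (oddSymFun k cs)
oddSymFun-Γ k []       = const 0ℚ
oddSymFun-Γ k (c ∷ cs) = (const c ⊗ podd k) ⊕ oddSymFun-Γ (suc k) cs

eval-oddSymFun : ∀ k cs xs → eval (oddSymFun k cs) xs ≡ sumℚ (map (expand oddPower k cs) xs)
eval-oddSymFun k []       xs = sym (sumℚ-map-0 xs)
eval-oddSymFun k (c ∷ cs) xs = begin
  c * sumℚ (map (oddPower k) xs) + eval (oddSymFun (suc k) cs) xs
    ≡⟨ cong₂ _+_ (sym (sumℚ-map-* c (oddPower k) xs)) (eval-oddSymFun (suc k) cs xs) ⟩
  sumℚ (map (λ x → c * oddPower k x) xs) + sumℚ (map (expand oddPower (suc k) cs) xs)
    ≡⟨ sumℚ-map-+ (λ x → c * oddPower k x) (expand oddPower (suc k) cs) xs ⟨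
  sumℚ (map (expand oddPower k (c ∷ cs)) xs) ∎
  where open ≡-Reasoning

hat : SymFun → SymFun
hat (const q) = const q
hat (psuc r)  = oddSymFun 0 (powerAntidifference r)
hat (f ⊕ g)   = hat f ⊕ hat g
hat (f ⊗ g)   = hat f ⊗ hat g

hat-Γ : ∀ F → InΓ (hat F)
hat-Γ (const q) = const q
hat-Γ (psuc r)  = oddSymFun-Γ 0 (powerAntidifference r)
hat-Γ (f ⊕ g)   = hat-Γ f ⊕ hat-Γ g
hat-Γ (f ⊗ g)   = hat-Γ f ⊗ hat-Γ g

hat-isHat : ∀ F → IsHat F (hat F)
hat-isHat (const q) la _ = refl
hat-isHat (psuc r)  la _ = begin
  eval (oddSymFun 0 (powerAntidifference r)) (map toℚ la)        ≡⟨ eval-oddSymFun 0 (powerAntidifference r) (map toℚ la) ⟩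
  sumℚ (map (oddPoly (powerAntidifference r)) (map toℚ la))      ≡⟨ cong sumℚ (map-∘ la) ⟨
  sumℚ (map (oddPoly (powerAntidifference r) ∘ toℚ) la)          ≡⟨ powerSum-shiftedRows r 1 la ⟨
  powerSum r (map chat (shifted la))                              ∎
  where open ≡-Reasoning
hat-isHat (f ⊕ g)   la sp = cong₂ _+_ (hat-isHat f la sp) (hat-isHat g la sp)
hat-isHat (f ⊗ g)   la sp = cong₂ _*_ (hat-isHat f la sp) (hat-isHat g la sp)

theorem1p4 : (F : SymFun) →
    Σ SymFun (λ G → (InΓ G × IsHat F G) ×
      ((G′ : SymFun) → InΓ G′ → IsHat F G′ → G′ ≈ G))
theorem1p4 F = hat F , (hat-Γ F , hat-isHat F) , λ G′ _ → isHat-unique F (hat F) G′ (hat-isHat F)
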